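{- The difference in independent domination stability between graphs with the same independent domination number can be arbitrarily large: for every positive integer $N$ there exist graphs $G$ and $H$ with $\gamma_i(G)=\gamma_i(H)$ and $|st_{id}(G)-st_{id}(H)|\ge N$.
   Context: All graphs are finite and simple. An independent dominating set of a graph $G$ is a set $S\subseteq V(G)$ of pairwise non-adjacent vertices such that every vertex not in $S$ has a neighbour in $S$. The independent domination number $\gamma_i(G)$ is the minimum size of an independent dominating set (for the null graph with no vertices, $\gamma_i=0$). The independent domination stability $st_{id}(G)$ is the minimum number of vertices whose removal from $G$ yields a graph with independent domination number different from $\gamma_i(G)$. -}

module Defs where

open import Data.Nat using (ℕ; _≤_)
open import Data.Fin using (Fin)
open import Data.Fin.Subset using (Subset; _∈_; _∉_; _⊆_; ∣_∣; ∁; ⊤)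
open import Data.Product using (Σ; ∃; _×_)
open import Relation.Binary.PropositionalEquality using (_≡_; _≢_)
open import Relation.Nullary using (¬_)
open import Level using (0ℓ; suc)

record Graph (n : ℕ) : Set₁ where
  field
    Adj   : Fin n → Fin n → Set
    sym   : ∀ {u v} → Adj u v → Adj v u
    irrefl : ∀ {v} → ¬ Adj v v
open Graph public

record IsIndDomSetIn {n : ℕ} (G : Graph n) (A D : Subset n) : Set where
  field
    inside      : D ⊆ A
    independent : ∀ {u v} → u ∈ D → v ∈ D → ¬ Adj G u v
    dominating  : ∀ {v} → v ∈ A → v ∉ D → ∃ λ u → u ∈ D × Adj G v u

-- γ_i(G[A]) = k : k is the minimum size of an independent dominating set
-- of the induced subgraph G[A].  (For A empty, the empty set qualifies, so k = 0.)
IsIndDomNumIn : {n : ℕ} → Graph n → Subset n → ℕ → Set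
IsIndDomNumIn G A k =
  (∃ λ D → IsIndDomSetIn G A D × ∣ D ∣ ≡ k)
  × (∀ D → IsIndDomSetIn G A D → k ≤ ∣ D ∣)

IsIndDomNum : {n : ℕ} → Graph n → ℕ → Set
IsIndDomNum G k = IsIndDomNumIn G ⊤ k

-- Removing the vertex set S changes γ_i: γ_i(G - S) ≠ γ_i(G),
-- where G - S is the induced subgraph on the complement ∁ S.
ChangesIndDom : {n : ℕ} → Graph n → Subset n → Set
ChangesIndDom G S =
  ∀ k k' → IsIndDomNum G k → IsIndDomNumIn G (∁ S) k' → k ≢ k'

IsIndDomStability : {n : ℕ} → Graph n → ℕ → Set
IsIndDomStability G s =
  (∃ λ S → ChangesIndDom G S × ∣ S ∣ ≡ s)
  × (∀ S → ChangesIndDom G S → s ≤ ∣ S ∣)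

{-# OPTIONS --safe #-}
module Submission where

-- In a complete graph any single vertex of a nonempty vertex set A dominates A, so
-- γ_i(K_n[A]) = 1 for every nonempty A.  Hence γ_i(K_n) = 1 survives the removal of
-- any proper subset of the vertices, while removing all of them leaves the null
-- graph with γ_i = 0; thus st_id(K_n) = n, and K_1, K_(N+1) are the required pair.

open import Defs
open import Data.Nat using (ℕ; suc; _≤_; ∣_-_∣)
open import Data.Nat.Properties using (≤-refl; module ≤-Reasoning)
open import Data.Product using (Σ; _×_; _,_)
open import Data.Fin using (Fin; zero)
open import Data.Fin.Subset using (Subset; _∈_; ∣_∣; ∁; ⊤; ⊥; ⁅_⁆; Nonempty)
open import Data.Fin.Subset.Properties
  using (_∈?_; x∈⁅x⁆; x∈⁅y⁆⇒x≡y; x∉⁅y⁆⇒x≢y; ∣⁅x⁆∣≡1; ∣⊥∣≡0; ∣⊤∣≡n; ∈⊤; ∉⊥;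
         x∈∁p⇒x∉p; x∉∁p⇒x∈p; p⊆q⇒∣p∣≤∣q∣; nonempty?)
open import Relation.Binary.PropositionalEquality using (_≢_; refl; trans; subst; ≢-sym)
  renaming (sym to ≡-sym)
open import Relation.Nullary using (yes; no; contradiction)

x∈p⇒1≤∣p∣ : ∀ {n} {x : Fin n} {p : Subset n} → x ∈ p → 1 ≤ ∣ p ∣
x∈p⇒1≤∣p∣ {x = x} {p} x∈p =
  subst (_≤ ∣ p ∣) (∣⁅x⁆∣≡1 x) (p⊆q⇒∣p∣≤∣q∣ λ y∈⁅x⁆ → subst (_∈ p) (≡-sym (x∈⁅y⁆⇒x≡y x y∈⁅x⁆)) x∈p)

⊤⊆p⇒n≤∣p∣ : ∀ {n} {p : Subset n} → (∀ x → x ∈ p) → n ≤ ∣ p ∣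
⊤⊆p⇒n≤∣p∣ {n} {p} all∈p = subst (_≤ ∣ p ∣) (∣⊤∣≡n n) (p⊆q⇒∣p∣≤∣q∣ {p = ⊤} λ {x} _ → all∈p x)

isIndDomSetIn⇒1≤∣D∣ : ∀ {n} {G : Graph n} {A D v} → IsIndDomSetIn G A D → v ∈ A → 1 ≤ ∣ D ∣
isIndDomSetIn⇒1≤∣D∣ {D = D} {v} isIDS v∈A with v ∈? D
... | yes v∈D = x∈p⇒1≤∣p∣ v∈D
... | no  v∉D with IsIndDomSetIn.dominating isIDS v∈A v∉D
...   | u , u∈D , _ = x∈p⇒1≤∣p∣ u∈D

⊥-isIndDomSetIn-∁⊤ : ∀ {n} (G : Graph n) → IsIndDomSetIn G (∁ ⊤) ⊥
⊥-isIndDomSetIn-∁⊤ G = record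
  { inside      = λ x∈⊥ → contradiction x∈⊥ ∉⊥
  ; independent = λ x∈⊥ _ → contradiction x∈⊥ ∉⊥
  ; dominating  = λ x∈∁⊤ _ → contradiction ∈⊤ (x∈∁p⇒x∉p x∈∁⊤)
  }

removeAll-changesIndDom : ∀ {n} (G : Graph (suc n)) → ChangesIndDom G ⊤
removeAll-changesIndDom {n} G k k' ((D , isIDS , ∣D∣≡k) , _) (_ , k'-min) refl =
  contradiction 1≤0 λ ()
  where
  1≤0 : 1 ≤ 0
  1≤0 = begin
    1              ≤⟨ isIndDomSetIn⇒1≤∣D∣ isIDS (∈⊤ {x = zero}) ⟩
    ∣ D ∣          ≡⟨ ∣D∣≡k ⟩
    k              ≤⟨ k'-min ⊥ (⊥-isIndDomSetIn-∁⊤ G) ⟩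
    ∣ ⊥ {suc n} ∣  ≡⟨ ∣⊥∣≡0 (suc n) ⟩
    0              ∎
    where open ≤-Reasoning

complete : (n : ℕ) → Graph n
complete n = record { Adj = _≢_ ; sym = ≢-sym ; irrefl = λ v≢v → v≢v refl }

⁅v⁆-isIndDomSetIn-complete : ∀ {n} {A : Subset n} {v} → v ∈ A → IsIndDomSetIn (complete n) A ⁅ v ⁆
⁅v⁆-isIndDomSetIn-complete {A = A} {v} v∈A = record
  { inside      = λ x∈⁅v⁆ → subst (_∈ A) (≡-sym (x∈⁅y⁆⇒x≡y v x∈⁅v⁆)) v∈A
  ; independent = λ x∈⁅v⁆ y∈⁅v⁆ x≢y → x≢y (trans (x∈⁅y⁆⇒x≡y v x∈⁅v⁆) (≡-sym (x∈⁅y⁆⇒x≡y v y∈⁅v⁆)))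
  ; dominating  = λ _ x∉⁅v⁆ → v , x∈⁅x⁆ v , x∉⁅y⁆⇒x≢y x∉⁅v⁆
  }

complete-indDomNumIn : ∀ {n} {A : Subset n} → Nonempty A → IsIndDomNumIn (complete n) A 1
complete-indDomNumIn (v , v∈A) =
  (⁅ v ⁆ , ⁅v⁆-isIndDomSetIn-complete v∈A , ∣⁅x⁆∣≡1 v) ,
  λ _ isIDS → isIndDomSetIn⇒1≤∣D∣ isIDS v∈A

complete-indDomNum : ∀ n → IsIndDomNum (complete (suc n)) 1
complete-indDomNum n = complete-indDomNumIn (zero , ∈⊤)

complete-changesIndDom⇒⊤⊆ : ∀ {n} {S} → ChangesIndDom (complete (suc n)) S → ∀ x → x ∈ S
complete-changesIndDom⇒⊤⊆ {n} {S} changes x with nonempty? (∁ S)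
... | yes ∁S≠∅ = contradiction refl (changes 1 1 (complete-indDomNum n) (complete-indDomNumIn ∁S≠∅))
... | no  ∁S=∅ = x∉∁p⇒x∈p λ x∈∁S → ∁S=∅ (x , x∈∁S)

complete-indDomStability : ∀ n → IsIndDomStability (complete (suc n)) (suc n)
complete-indDomStability n =
  (⊤ , removeAll-changesIndDom (complete (suc n)) , ∣⊤∣≡n (suc n)) ,
  λ S changes → ⊤⊆p⇒n≤∣p∣ (complete-changesIndDom⇒⊤⊆ changes)

mainTheorem2 : (N : ℕ) → 1 ≤ N →
    Σ ℕ λ n → Σ ℕ λ m → Σ (Graph n) λ G → Σ (Graph m) λ H →
    Σ ℕ λ g → Σ ℕ λ s → Σ ℕ λ t →
      IsIndDomNum G g × IsIndDomNum H g ×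
      IsIndDomStability G s × IsIndDomStability H t ×
      N ≤ ∣ s - t ∣
mainTheorem2 N _ =
  1 , suc N , complete 1 , complete (suc N) , 1 , 1 , suc N ,
  complete-indDomNum 0 , complete-indDomNum N ,
  complete-indDomStability 0 , complete-indDomStability N ,
  ≤-refl  -- ∣ 1 - suc N ∣ reduces to N
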